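{- Suppose there is a jump from $\alpha=(a_1,a_2)\in D_a$ to $\beta=(b_1,b_2)\in D_b$. If $\gamma=(g_1,g_2)\in D_g$ with $a<g<b$ or $b<g<a$, then either $\alpha$ makes a jump to $\gamma$ or $\gamma$ makes a jump to $\beta$.
   Context: $[m]\times[n]=\{(i,j)\in\mathbb{Z}^2:1\le i\le m,1\le j\le n\}$, all points lie in $[m]\times[n]$, and $D_k=\{(i,j)\in[m]\times[n]:m-k=i-j\}$. For $\alpha=(a_1,a_2)\in D_a$ and $\beta=(b_1,b_2)\in D_b$ with $a\ne b$, there is a jump from $\alpha$ to $\beta$ ($\alpha$ makes a jump to $\beta$) if $a_1<b_1$ and $a_2<b_2$. -}

module Defs where

open import Data.Nat using (ℕ; _≤_; _<_)
open import Data.Integer as ℤ using (ℤ; +_)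
open import Data.Product using (_×_; _,_)
open import Relation.Binary.PropositionalEquality using (_≡_; _≢_)

Point : Set
Point = ℕ × ℕ

InGrid : ℕ → ℕ → Point → Set
InGrid m n (i , j) = (1 ≤ i × i ≤ m) × (1 ≤ j × j ≤ n)

InD : ℕ → ℕ → ℤ → Point → Set
InD m n k (i , j) = InGrid m n (i , j) × ((+ m) ℤ.- k ≡ (+ i) ℤ.- (+ j))

Jump : ℤ → Point → ℤ → Point → Set
Jump a (a₁ , a₂) b (b₁ , b₂) = (a ≢ b) × (a₁ < b₁) × (a₂ < b₂)

-- A point (i , j) of D_k satisfies i - j = m - k, so the diagonal index decreases as i - j
-- grows. If α ↦ β is a jump and γ lies on a diagonal strictly between, then i - j of γ lies
-- strictly between those of α and β. When i - j decreases from α to β (a < g < b), either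
-- g₁ > a₁, and then γ cannot lag behind α in the second coordinate; or g₁ ≤ a₁ < b₁, and
-- then β cannot lag behind γ in the second coordinate. The case b < g < a is the same with
-- the two coordinates exchanged.
module Submission where

open import Defs
open import Data.Nat as ℕ using (ℕ)
import Data.Nat.Properties as ℕ
open import Data.Integer using (ℤ; _<_; _≤_; +_; -_; _-_; +<+; +≤+)
import Data.Integer.Properties as ℤ
open import Data.Product using (_×_; _,_; proj₁; proj₂)
open import Data.Sum using (_⊎_; inj₁; inj₂)
open import Relation.Binary.PropositionalEquality using (subst₂; ≢-sym)
open import Relation.Nullary using (yes; no)

diag : Point → ℤ
diag (i , j) = + i - + j

diag-<-of-InD : ∀ {m n a b p q} → InD m n a p → InD m n b q → a < b → diag q < diag p
diag-<-of-InD {m} (_ , p∈Da) (_ , q∈Db) a<b =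
  subst₂ _<_ q∈Db p∈Da (ℤ.+-monoʳ-< (+ m) (ℤ.neg-mono-< a<b))

diag-<-of-≤-< : ∀ {p q : Point} → proj₁ p ℕ.≤ proj₁ q → proj₂ q ℕ.< proj₂ p → diag p < diag q
diag-<-of-≤-< p₁≤q₁ q₂<p₂ = ℤ.+-mono-≤-< (+≤+ p₁≤q₁) (ℤ.neg-mono-< (+<+ q₂<p₂))

diag-<-of-<-≤ : ∀ {p q : Point} → proj₁ p ℕ.< proj₁ q → proj₂ q ℕ.≤ proj₂ p → diag p < diag q
diag-<-of-<-≤ p₁<q₁ q₂≤p₂ = ℤ.+-mono-<-≤ (+<+ p₁<q₁) (ℤ.neg-mono-≤ (+≤+ q₂≤p₂))

snd-<-of-fst-< : ∀ {p q : Point} → diag q ≤ diag p → proj₁ p ℕ.< proj₁ q → proj₂ p ℕ.< proj₂ q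
snd-<-of-fst-< q≤p p₁<q₁ = ℕ.≰⇒> λ q₂≤p₂ → ℤ.<⇒≱ (diag-<-of-<-≤ p₁<q₁ q₂≤p₂) q≤p

fst-<-of-snd-< : ∀ {p q : Point} → diag p ≤ diag q → proj₂ p ℕ.< proj₂ q → proj₁ p ℕ.< proj₁ q
fst-<-of-snd-< p≤q p₂<q₂ = ℕ.≰⇒> λ q₁≤p₁ → ℤ.<⇒≱ (diag-<-of-≤-< q₁≤p₁ p₂<q₂) p≤q

lemma2p13 : (m n : ℕ) (a b g : ℤ) (α β γ : Point) →
    InD m n a α → InD m n b β → InD m n g γ →
    Jump a α b β →
    ((a < g × g < b) ⊎ (b < g × g < a)) →
    Jump a α g γ ⊎ Jump g γ b β
lemma2p13 m n a b g (a₁ , a₂) (b₁ , b₂) (g₁ , g₂) α∈Da β∈Db γ∈Dg (_ , a₁<b₁ , a₂<b₂)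
  (inj₁ (a<g , g<b)) with g₁ ℕ.≤? a₁
... | no g₁≰a₁ = inj₁ (ℤ.<⇒≢ a<g , a₁<g₁ , snd-<-of-fst-< (ℤ.<⇒≤ γ<α) a₁<g₁)
  where
  a₁<g₁ : a₁ ℕ.< g₁
  a₁<g₁ = ℕ.≰⇒> g₁≰a₁
  γ<α : diag (g₁ , g₂) < diag (a₁ , a₂)
  γ<α = diag-<-of-InD α∈Da γ∈Dg a<g
... | yes g₁≤a₁ = inj₂ (ℤ.<⇒≢ g<b , g₁<b₁ , snd-<-of-fst-< (ℤ.<⇒≤ β<γ) g₁<b₁)
  where
  g₁<b₁ : g₁ ℕ.< b₁
  g₁<b₁ = ℕ.≤-<-trans g₁≤a₁ a₁<b₁
  β<γ : diag (b₁ , b₂) < diag (g₁ , g₂)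
  β<γ = diag-<-of-InD γ∈Dg β∈Db g<b
lemma2p13 m n a b g (a₁ , a₂) (b₁ , b₂) (g₁ , g₂) α∈Da β∈Db γ∈Dg (_ , a₁<b₁ , a₂<b₂)
  (inj₂ (b<g , g<a)) with g₂ ℕ.≤? a₂
... | no g₂≰a₂ = inj₁ (≢-sym (ℤ.<⇒≢ g<a) , fst-<-of-snd-< (ℤ.<⇒≤ α<γ) a₂<g₂ , a₂<g₂)
  where
  a₂<g₂ : a₂ ℕ.< g₂
  a₂<g₂ = ℕ.≰⇒> g₂≰a₂
  α<γ : diag (a₁ , a₂) < diag (g₁ , g₂)
  α<γ = diag-<-of-InD γ∈Dg α∈Da g<a
... | yes g₂≤a₂ = inj₂ (≢-sym (ℤ.<⇒≢ b<g) , fst-<-of-snd-< (ℤ.<⇒≤ γ<β) g₂<b₂ , g₂<b₂)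
  where
  g₂<b₂ : g₂ ℕ.< b₂
  g₂<b₂ = ℕ.≤-<-trans g₂≤a₂ a₂<b₂
  γ<β : diag (g₁ , g₂) < diag (b₁ , b₂)
  γ<β = diag-<-of-InD β∈Db γ∈Dg b<g
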